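{- Let $G$ be a connected threshold graph with binary string $b=0^{s_1}1^{t_1}\cdots 0^{s_k}1^{t_k}$ (all $s_i,t_i\geq1$). Let $m=2k$ if $s_1=1$ and $m=2k+1$ if $s_1\geq 2$. Then the anti-regular graph $A_m$ is isomorphic to an induced subgraph of $G$, and $A_m$ is the largest anti-regular graph contained in $G$ as an induced subgraph.
   Context: For a binary string $b=b_1b_2\cdots b_n$ with $b_1=0$, the threshold graph $G(b)$ is constructed as follows: start with a single vertex $v_1$; for $j=2,\ldots,n$ add a new vertex $v_j$ which is adjacent to all of $v_1,\ldots,v_{j-1}$ if $b_j=1$ and to none of them if $b_j=0$. Every threshold graph is of this form, and $G(b)$ is connected iff $b_n=1$; thus a connected threshold graph on $n\geq2$ vertices has a binary string of the form $b=0^{s_1}1^{t_1}\cdots 0^{s_k}1^{t_k}$ with all $s_i,t_i\geq1$, where $0^{s}$ (resp. $1^t$) denotes $s$ consecutive zeros (resp. $t$ consecutive ones). For $m\geq 2$, the anti-regular graph $A_m$ is $G(0101\cdots01)$ (alternating string of length $m$) when $m$ is even and $G(00101\cdots 01)$ (length $m$) when $m$ is odd; equivalently, $A_m$ is the unique connected graph on $m$ vertices whose degree sequence has exactly $m-1$ distinct values. -}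

module Defs where

open import Data.Nat using (ℕ; zero; suc; _+_; _*_; _≤_; _<_; _<ᵇ_)
open import Data.Bool using (Bool; true; false)
open import Data.Fin using (Fin; toℕ)
open import Data.List using (List; []; _∷_; replicate; _++_; length; concatMap; lookup; head)
open import Data.Product using (_×_; _,_; Σ; ∃)
open import Data.Maybe using (Maybe; just)
open import Relation.Binary.PropositionalEquality using (_≡_; _≢_)
open import Function.Definitions using (Injective)
open import Relation.Nullary using (¬_)

-- A binary string is a list of booleans: false = 0, true = 1.
BinStr : Set
BinStr = List Bool

-- Adjacency of the threshold graph G(b) on vertex set Fin (length b)
-- (vertex i corresponds to v_{i+1}): for i ≠ j, v_i ~ v_j iff the bit
-- of the later-added vertex is 1. No loops.
thresholdAdj : (b : BinStr) → Fin (length b) → Fin (length b) → Bool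
thresholdAdj b i j with toℕ i <ᵇ toℕ j | toℕ j <ᵇ toℕ i
... | true  | _     = lookup b j
... | false | true  = lookup b i
... | false | false = false

record Graph : Set where
  constructor mkGraph
  field
    V   : ℕ
    adj : Fin V → Fin V → Bool

open Graph public

G : BinStr → Graph
G b = mkGraph (length b) (thresholdAdj b)

_≲ind_ : Graph → Graph → Set
H ≲ind K = Σ (Fin (V H) → Fin (V K)) λ f →
  Injective _≡_ _≡_ f × (∀ u v → u ≢ v → adj H u v ≡ adj K (f u) (f v))

-- Binary string of the anti-regular graph A_m:
-- (01)^{m/2} for m even, 0(01)^{(m-1)/2} for m odd.
antiRegStr : ℕ → BinStr
antiRegStr m = pre m
  where
  pre : ℕ → BinStr
  pre zero          = []
  pre (suc zero)    = false ∷ []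
  pre (suc (suc n)) = pre n ++ (false ∷ true ∷ [])

-- The anti-regular graph A_m (meaningful for m ≥ 2).
A : ℕ → Graph
A m = G (antiRegStr m)

blockStr : List (ℕ × ℕ) → BinStr
blockStr [] = []
blockStr ((s , t) ∷ bs) = replicate s false ++ replicate t true ++ blockStr bs

data AllPos : List (ℕ × ℕ) → Set where
  []  : AllPos []
  _∷_ : ∀ {s t bs} → 1 ≤ s → 1 ≤ t → AllPos bs → AllPos ((s , t) ∷ bs)

-- Let b = a ∷ l be a threshold string.  A maximal constant stretch of l
-- (a "run") gives a set of twins in G(b): vertices whose adjacency to every
-- other vertex agrees (vertex 0 joins the run of vertex 1).  Hence G(b) has
-- at most totalChanges l + 1 twin classes, where totalChanges l counts the
-- positions where l changes bit.  The anti-regular strings 0101…01 and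
-- 00101…01 alternate from position 1 on, and in such a string no two
-- distinct vertices other than vertex 0 are twins.  Twins are reflected by
-- induced embeddings, so an induced copy of A_m puts its m - 1 vertices
-- 1, …, m - 1 into distinct twin classes: m ≤ 2 + totalChanges l.
-- For b = 0^{s₁}1^{t₁}…0^{s_k}1^{t_k}, totalChanges l is 2k - 2 if s₁ = 1
-- and 2k - 1 if s₁ ≥ 2, which is the upper bound.  Conversely the
-- anti-regular string of that length is a subsequence of b (one bit from
-- each block, two zeros from the first block when s₁ ≥ 2), and a
-- subsequence of a threshold string spans an induced subgraph.
module Submission where

open import Defs
open import Data.Nat using (ℕ; zero; suc; pred; _+_; _*_; _≤_; _<_; _<ᵇ_; z≤n; s≤s; s≤s⁻¹)
open import Data.Nat.Properties
open import Data.Bool using (Bool; true; false)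
open import Data.List using (List; []; _∷_; _++_; replicate; length; lookup)
open import Data.List.Properties using (length-++)
open import Data.List.Relation.Binary.Sublist.Propositional using (_⊆_; []; _∷_; _∷ʳ_; minimum)
open import Data.List.Relation.Binary.Sublist.Propositional.Properties using (++⁺)
open import Data.Fin as Fin using (Fin; toℕ)
import Data.Fin.Properties as Fin
open import Data.Product using (_×_; _,_; ∃-syntax)
open import Data.Sum using (_⊎_; inj₁; inj₂)
open import Data.Empty using (⊥-elim)
open import Function using (_∘_)
open import Relation.Nullary using (¬_; yes; no)
open import Relation.Binary.PropositionalEquality
open import Relation.Binary.Definitions using (tri<; tri≈; tri>)
open ≡-Reasoning

-- Total indexing of a string (out-of-range positions read 0).
bit : BinStr → ℕ → Bool
bit []      _       = false
bit (x ∷ _) zero    = x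
bit (_ ∷ l) (suc n) = bit l n

lookup≡bit : ∀ b (i : Fin (length b)) → lookup b i ≡ bit b (toℕ i)
lookup≡bit (x ∷ b) Fin.zero    = refl
lookup≡bit (x ∷ b) (Fin.suc i) = lookup≡bit b i

adj-later : ∀ b (i j : Fin (length b)) → toℕ i < toℕ j → thresholdAdj b i j ≡ bit b (toℕ j)
adj-later b i j i<j with toℕ i <ᵇ toℕ j | <⇒<ᵇ i<j
... | true | _ = lookup≡bit b j

adj-earlier : ∀ b (i j : Fin (length b)) → toℕ j < toℕ i → thresholdAdj b i j ≡ bit b (toℕ i)
adj-earlier b i j j<i with toℕ i <ᵇ toℕ j | <ᵇ⇒< (toℕ i) (toℕ j) | toℕ j <ᵇ toℕ i | <⇒<ᵇ j<i
... | true  | i<j | _    | _ = ⊥-elim (<-asym j<i (i<j _))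
... | false | _   | true | _ = lookup≡bit b i

embed : ∀ {c b : BinStr} → c ⊆ b → Fin (length c) → Fin (length b)
embed (y ∷ʳ τ) i           = Fin.suc (embed τ i)
embed (_ ∷ τ)  Fin.zero    = Fin.zero
embed (_ ∷ τ)  (Fin.suc i) = Fin.suc (embed τ i)

embed-lookup : ∀ {c b} (τ : c ⊆ b) i → lookup b (embed τ i) ≡ lookup c i
embed-lookup (y ∷ʳ τ)    i           = embed-lookup τ i
embed-lookup (refl ∷ τ)  Fin.zero    = refl
embed-lookup (_ ∷ τ)     (Fin.suc i) = embed-lookup τ i

embed-monotone : ∀ {c b} (τ : c ⊆ b) i j → toℕ i < toℕ j → toℕ (embed τ i) < toℕ (embed τ j)
embed-monotone (y ∷ʳ τ) i           j           i<j       = s≤s (embed-monotone τ i j i<j)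
embed-monotone (_ ∷ τ)  Fin.zero    (Fin.suc j) _         = s≤s z≤n
embed-monotone (_ ∷ τ)  (Fin.suc i) (Fin.suc j) (s≤s i<j) = s≤s (embed-monotone τ i j i<j)

embed-injective : ∀ {c b} (τ : c ⊆ b) {i j} → embed τ i ≡ embed τ j → i ≡ j
embed-injective (y ∷ʳ τ) e = embed-injective τ (Fin.suc-injective e)
embed-injective (_ ∷ τ) {Fin.zero}  {Fin.zero}  e = refl
embed-injective (_ ∷ τ) {Fin.suc i} {Fin.suc j} e =
  cong Fin.suc (embed-injective τ (Fin.suc-injective e))

-- Both adjacency and non-adjacency are decided by the later bit, which the
-- embedding preserves together with the order of positions.
sublist⇒induced : ∀ {c b} → c ⊆ b → G c ≲ind G b
sublist⇒induced {c} {b} τ = embed τ , embed-injective τ , preserves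
  where
  preserves : ∀ u v → u ≢ v → thresholdAdj c u v ≡ thresholdAdj b (embed τ u) (embed τ v)
  preserves u v u≢v with <-cmp (toℕ u) (toℕ v)
  ... | tri≈ _ u=v _ = ⊥-elim (u≢v (Fin.toℕ-injective u=v))
  ... | tri< u<v _ _ = begin
    thresholdAdj c u v                   ≡⟨ adj-later c u v u<v ⟩
    bit c (toℕ v)                        ≡⟨ sym (lookup≡bit c v) ⟩
    lookup c v                           ≡⟨ sym (embed-lookup τ v) ⟩
    lookup b (embed τ v)                 ≡⟨ lookup≡bit b (embed τ v) ⟩
    bit b (toℕ (embed τ v))              ≡⟨ sym (adj-later b _ _ (embed-monotone τ u v u<v)) ⟩
    thresholdAdj b (embed τ u) (embed τ v) ∎
  ... | tri> _ _ v<u = begin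
    thresholdAdj c u v                   ≡⟨ adj-earlier c u v v<u ⟩
    bit c (toℕ u)                        ≡⟨ sym (lookup≡bit c u) ⟩
    lookup c u                           ≡⟨ sym (embed-lookup τ u) ⟩
    lookup b (embed τ u)                 ≡⟨ lookup≡bit b (embed τ u) ⟩
    bit b (toℕ (embed τ u))              ≡⟨ sym (adj-earlier b _ _ (embed-monotone τ v u v<u)) ⟩
    thresholdAdj b (embed τ u) (embed τ v) ∎

change : Bool → Bool → ℕ
change false false = 0
change true  true  = 0
change false true  = 1
change true  false = 1

change-refl : ∀ x → change x x ≡ 0
change-refl false = refl
change-refl true  = refl

no-change : ∀ x y → change x y ≡ 0 → x ≡ y
no-change false false _ = refl
no-change true  true  _ = refl

changes : BinStr → ℕ → ℕ
changes l zero    = 0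
changes l (suc q) = changes l q + change (bit l q) (bit l (suc q))

changes-monotone : ∀ l {x y} → x ≤ y → changes l x ≤ changes l y
changes-monotone l {y = zero} z≤n = ≤-refl
changes-monotone l {x} {suc y} x≤1+y with m≤n⇒m<n∨m≡n x≤1+y
... | inj₂ refl  = ≤-refl
... | inj₁ x<1+y = ≤-trans (changes-monotone l (s≤s⁻¹ x<1+y)) (m≤m+n _ _)

no-change-between : ∀ l {x y p} → changes l x ≡ changes l y → x ≤ p → p < y →
                    bit l p ≡ bit l (suc p)
no-change-between l {x} {y} {p} same x≤p p<y =
  no-change _ _ (n≤0⇒n≡0 (+-cancelˡ-≤ (changes l p) _ 0 no-growth))
  where
  no-growth : changes l (suc p) ≤ changes l p + 0
  no-growth = ≤-trans (changes-monotone l p<y)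
             (≤-trans (≤-reflexive (sym same))
             (≤-trans (changes-monotone l x≤p) (≤-reflexive (sym (+-identityʳ _)))))

constant-between : ∀ l {x y} → changes l x ≡ changes l y →
                   ∀ p → x ≤ p → p ≤ y → bit l p ≡ bit l x
constant-between l same zero    z≤n _ = refl
constant-between l same (suc p) x≤1+p 1+p≤y with m≤n⇒m<n∨m≡n x≤1+p
... | inj₂ refl  = refl
... | inj₁ x<1+p = trans (sym (no-change-between l same (s≤s⁻¹ x<1+p) 1+p≤y))
                         (constant-between l same p (s≤s⁻¹ x<1+p) (<⇒≤ 1+p≤y))

totalChanges : BinStr → ℕ
totalChanges []          = 0
totalChanges (x ∷ [])    = 0
totalChanges (x ∷ y ∷ r) = change x y + totalChanges (y ∷ r)

changes-cons : ∀ x y r q → changes (x ∷ y ∷ r) (suc q) ≡ change x y + changes (y ∷ r) q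
changes-cons x y r zero    = sym (+-identityʳ (change x y))
changes-cons x y r (suc q) = begin
  changes (x ∷ y ∷ r) (suc q) + change (bit (y ∷ r) q) (bit (y ∷ r) (suc q))
    ≡⟨ cong (_+ change (bit (y ∷ r) q) (bit (y ∷ r) (suc q))) (changes-cons x y r q) ⟩
  change x y + changes (y ∷ r) q + change (bit (y ∷ r) q) (bit (y ∷ r) (suc q))
    ≡⟨ +-assoc (change x y) _ _ ⟩
  change x y + changes (y ∷ r) (suc q) ∎

changes≤total : ∀ l q → q < length l → changes l q ≤ totalChanges l
changes≤total (x ∷ [])    zero    _         = z≤n
changes≤total (x ∷ [])    (suc q) (s≤s ())
changes≤total (x ∷ y ∷ r) zero    _         = z≤n
changes≤total (x ∷ y ∷ r) (suc q) (s≤s q<n) =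
  ≤-trans (≤-reflexive (changes-cons x y r q)) (+-monoʳ-≤ (change x y) (changes≤total (y ∷ r) q q<n))

Twins : (H : Graph) → Fin (V H) → Fin (V H) → Set
Twins H u v = ∀ z → z ≢ u → z ≢ v → adj H u z ≡ adj H v z

twins-sym : ∀ {H u v} → Twins H u v → Twins H v u
twins-sym tw z z≢v z≢u = sym (tw z z≢u z≢v)

induced-reflects-twins : ∀ {H K} (e : H ≲ind K) → let (f , _) = e in
                         ∀ {u v} → Twins K (f u) (f v) → Twins H u v
induced-reflects-twins {H} {K} (f , injective , preserves) {u} {v} tw z z≢u z≢v = begin
  adj H u z         ≡⟨ preserves u z (≢-sym z≢u) ⟩
  adj K (f u) (f z) ≡⟨ tw (f z) (z≢u ∘ injective) (z≢v ∘ injective) ⟩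
  adj K (f v) (f z) ≡⟨ sym (preserves v z (≢-sym z≢v)) ⟩
  adj H v z         ∎

Uniform : BinStr → ℕ → ℕ → Set
Uniform b x y = ∀ p → x ≤ p → p ≤ y → 1 ≤ p → bit b p ≡ bit b y

-- A vertex z between X and Y sees X through bit z and Y through bit Y; one
-- before X sees X through bit X (X ≥ 1 then); one after Y sees both through
-- bit z.
uniform⇒twins : ∀ b (X Y : Fin (length b)) → toℕ X < toℕ Y → Uniform b (toℕ X) (toℕ Y) →
                Twins (G b) X Y
uniform⇒twins b X Y X<Y uniform z z≢X z≢Y with <-cmp (toℕ z) (toℕ X)
... | tri≈ _ z=X _ = ⊥-elim (z≢X (Fin.toℕ-injective z=X))
... | tri< z<X _ _ = begin
  thresholdAdj b X z ≡⟨ adj-earlier b X z z<X ⟩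
  bit b (toℕ X)      ≡⟨ uniform (toℕ X) ≤-refl (<⇒≤ X<Y) (≤-trans (s≤s z≤n) z<X) ⟩
  bit b (toℕ Y)      ≡⟨ sym (adj-earlier b Y z (<-trans z<X X<Y)) ⟩
  thresholdAdj b Y z ∎
... | tri> _ _ X<z with <-cmp (toℕ z) (toℕ Y)
...   | tri≈ _ z=Y _ = ⊥-elim (z≢Y (Fin.toℕ-injective z=Y))
...   | tri> _ _ Y<z = trans (adj-later b X z X<z) (sym (adj-later b Y z Y<z))
...   | tri< z<Y _ _ = begin
  thresholdAdj b X z ≡⟨ adj-later b X z X<z ⟩
  bit b (toℕ z)      ≡⟨ uniform (toℕ z) (<⇒≤ X<z) (<⇒≤ z<Y) (≤-trans (s≤s z≤n) X<z) ⟩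
  bit b (toℕ Y)      ≡⟨ sym (adj-earlier b Y z z<Y) ⟩
  thresholdAdj b Y z ∎

-- The run of vertex x of G(a ∷ l): the number of changes of l before
-- position x - 1 (vertices 0 and 1 share run 0).
run : BinStr → ℕ → ℕ
run l x = changes l (pred x)

sameRun⇒uniform : ∀ a l {x y} → run l x ≡ run l y → Uniform (a ∷ l) x y
sameRun⇒uniform a l                same zero    _     _       ()
sameRun⇒uniform a l {y = zero}     same (suc p) _     ()      _
sameRun⇒uniform a l {x} {suc y}    same (suc p) x≤1+p 1+p≤1+y _ =
  trans (constant-between l same p (pred-mono-≤ x≤1+p) (s≤s⁻¹ 1+p≤1+y))
        (sym (constant-between l same y (pred-mono-≤ (≤-trans x≤1+p 1+p≤1+y)) ≤-refl))

sameRun⇒twins : ∀ a l (X Y : Fin (length (a ∷ l))) → run l (toℕ X) ≡ run l (toℕ Y) →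
                Twins (G (a ∷ l)) X Y
sameRun⇒twins a l X Y same with <-cmp (toℕ X) (toℕ Y)
... | tri< X<Y _ _ = uniform⇒twins (a ∷ l) X Y X<Y (sameRun⇒uniform a l same)
... | tri> _ _ Y<X = twins-sym (uniform⇒twins (a ∷ l) Y X Y<X (sameRun⇒uniform a l (sym same)))
... | tri≈ _ X=Y _ with Fin.toℕ-injective X=Y
...   | refl = λ _ _ _ → refl

run-bound : ∀ a l (X : Fin (length (a ∷ l))) → run l (toℕ X) ≤ totalChanges l
run-bound a l Fin.zero    = z≤n
run-bound a l (Fin.suc X) = changes≤total l (toℕ X) (Fin.toℕ<n X)

Alternating : BinStr → Set
Alternating c = ∀ p → 1 ≤ p → suc p < length c → bit c p ≢ bit c (suc p)

-- For 1 ≤ U < V, the vertex V - 1 (or vertex 0 if U = V - 1) sees U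
-- through one bit and V through the next one, and these differ.
alternating⇒not-twins< : ∀ c → Alternating c → (U V : Fin (length c)) →
                         1 ≤ toℕ U → toℕ U < toℕ V → ¬ Twins (G c) U V
alternating⇒not-twins< (c₀ ∷ c) alt U (Fin.suc W) 1≤U (s≤s U≤W) twins
  with m≤n⇒m<n∨m≡n U≤W
... | inj₁ U<W = alt (toℕ W) (≤-trans 1≤U (<⇒≤ U<W)) (Fin.toℕ<n (Fin.suc W)) (begin
  bit (c₀ ∷ c) (toℕ W)              ≡⟨ cong (bit (c₀ ∷ c)) (sym W′≡W) ⟩
  bit (c₀ ∷ c) (toℕ W′)             ≡⟨ sym (adj-later (c₀ ∷ c) U W′ (subst (toℕ U <_) (sym W′≡W) U<W)) ⟩
  thresholdAdj (c₀ ∷ c) U W′        ≡⟨ twins W′ W′≢U W′≢V ⟩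
  thresholdAdj (c₀ ∷ c) (Fin.suc W) W′ ≡⟨ adj-earlier (c₀ ∷ c) (Fin.suc W) W′ (s≤s (≤-reflexive W′≡W)) ⟩
  bit (c₀ ∷ c) (suc (toℕ W))        ∎)
  where
  W′ : Fin (length (c₀ ∷ c))
  W′ = Fin.inject₁ W
  W′≡W : toℕ W′ ≡ toℕ W
  W′≡W = Fin.toℕ-inject₁ W
  W′≢U : W′ ≢ U
  W′≢U W′=U = <-irrefl (trans (sym (cong toℕ W′=U)) W′≡W) U<W
  W′≢V : W′ ≢ Fin.suc W
  W′≢V W′=V = <-irrefl (trans (sym W′≡W) (cong toℕ W′=V)) (n<1+n (toℕ W))
... | inj₂ U≡W = alt (toℕ U) 1≤U (subst (λ w → suc w < suc (length c)) (sym U≡W) (Fin.toℕ<n (Fin.suc W))) (begin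
  bit (c₀ ∷ c) (toℕ U)                   ≡⟨ sym (adj-earlier (c₀ ∷ c) U Fin.zero 1≤U) ⟩
  thresholdAdj (c₀ ∷ c) U Fin.zero       ≡⟨ twins Fin.zero (λ 0=U → <-irrefl (cong toℕ 0=U) 1≤U) (λ ()) ⟩
  thresholdAdj (c₀ ∷ c) (Fin.suc W) Fin.zero ≡⟨ adj-earlier (c₀ ∷ c) (Fin.suc W) Fin.zero (s≤s z≤n) ⟩
  bit (c₀ ∷ c) (suc (toℕ W))             ≡⟨ cong (bit (c₀ ∷ c) ∘ suc) (sym U≡W) ⟩
  bit (c₀ ∷ c) (suc (toℕ U))             ∎)

alternating⇒not-twins : ∀ c → Alternating c → (U V : Fin (length c)) →
                        1 ≤ toℕ U → 1 ≤ toℕ V → U ≢ V → ¬ Twins (G c) U V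
alternating⇒not-twins c alt U V 1≤U 1≤V U≢V with <-cmp (toℕ U) (toℕ V)
... | tri< U<V _ _ = alternating⇒not-twins< c alt U V 1≤U U<V
... | tri> _ _ V<U = alternating⇒not-twins< c alt V U 1≤V V<U ∘ twins-sym
... | tri≈ _ U=V _ = ⊥-elim (U≢V (Fin.toℕ-injective U=V))

-- Pigeonhole: an induced copy of G(c) sends vertices 1, 2, … of c into
-- pairwise different runs of G(a ∷ l).
alternating-bound : ∀ c a l → Alternating c → G c ≲ind G (a ∷ l) → length c ≤ 2 + totalChanges l
alternating-bound []       a l alt _ = z≤n
alternating-bound (c₀ ∷ c) a l alt e@(f , _ , _) = s≤s (Fin.injective⇒≤ runOf-injective)
  where
  runOf : Fin (length c) → Fin (suc (totalChanges l))
  runOf u = Fin.fromℕ< (s≤s (run-bound a l (f (Fin.suc u))))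

  runOf-injective : ∀ {u v} → runOf u ≡ runOf v → u ≡ v
  runOf-injective {u} {v} same with u Fin.≟ v
  ... | yes u≡v = u≡v
  ... | no u≢v  = ⊥-elim (alternating⇒not-twins (c₀ ∷ c) alt (Fin.suc u) (Fin.suc v)
                     (s≤s z≤n) (s≤s z≤n) (u≢v ∘ Fin.suc-injective)
                     (induced-reflects-twins {G (c₀ ∷ c)} {G (a ∷ l)} e (sameRun⇒twins a l _ _ sameRun)))
    where
    sameRun : run l (toℕ (f (Fin.suc u))) ≡ run l (toℕ (f (Fin.suc v)))
    sameRun = trans (sym (Fin.toℕ-fromℕ< _)) (trans (cong toℕ same) (Fin.toℕ-fromℕ< _))

alt : ℕ → BinStr
alt zero    = []
alt (suc j) = false ∷ true ∷ alt j

alt-snoc : ∀ j → alt (suc j) ≡ alt j ++ (false ∷ true ∷ [])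
alt-snoc zero    = refl
alt-snoc (suc j) = cong (λ l → false ∷ true ∷ l) (alt-snoc j)

antiRegStr-even : ∀ j → antiRegStr (2 * j) ≡ alt j
antiRegStr-even zero    = refl
antiRegStr-even (suc j) = begin
  antiRegStr (2 * suc j)                  ≡⟨ cong antiRegStr (*-suc 2 j) ⟩
  antiRegStr (2 * j) ++ false ∷ true ∷ [] ≡⟨ cong (_++ false ∷ true ∷ []) (antiRegStr-even j) ⟩
  alt j ++ false ∷ true ∷ []              ≡⟨ sym (alt-snoc j) ⟩
  alt (suc j)                             ∎

antiRegStr-odd : ∀ j → antiRegStr (2 * j + 1) ≡ false ∷ alt j
antiRegStr-odd zero    = refl
antiRegStr-odd (suc j) = begin
  antiRegStr (2 * suc j + 1)                  ≡⟨ cong (antiRegStr ∘ (_+ 1)) (*-suc 2 j) ⟩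
  antiRegStr (2 * j + 1) ++ false ∷ true ∷ [] ≡⟨ cong (_++ false ∷ true ∷ []) (antiRegStr-odd j) ⟩
  false ∷ alt j ++ false ∷ true ∷ []          ≡⟨ cong (false ∷_) (sym (alt-snoc j)) ⟩
  false ∷ alt (suc j)                         ∎

length-antiRegStr : ∀ m → length (antiRegStr m) ≡ m
length-antiRegStr zero          = refl
length-antiRegStr (suc zero)    = refl
length-antiRegStr (suc (suc m)) = begin
  length (antiRegStr m ++ false ∷ true ∷ []) ≡⟨ length-++ (antiRegStr m) ⟩
  length (antiRegStr m) + 2                  ≡⟨ cong (_+ 2) (length-antiRegStr m) ⟩
  m + 2                                      ≡⟨ +-comm m 2 ⟩
  suc (suc m)                                ∎

even-or-odd : ∀ m → ∃[ j ] (m ≡ 2 * j ⊎ m ≡ 2 * j + 1)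
even-or-odd zero = 0 , inj₁ refl
even-or-odd (suc m) with even-or-odd m
... | j , inj₁ refl = j , inj₂ (+-comm 1 (2 * j))
... | j , inj₂ refl = suc j , inj₁ (trans (cong suc (+-comm (2 * j) 1)) (sym (*-suc 2 j)))

alt-changes-everywhere : ∀ j p → suc p < length (alt j) → bit (alt j) p ≢ bit (alt j) (suc p)
alt-changes-everywhere (suc j)       zero          _             ()
alt-changes-everywhere (suc zero)    (suc zero)    (s≤s (s≤s ()))
alt-changes-everywhere (suc (suc j)) (suc zero)    _             ()
alt-changes-everywhere (suc j)       (suc (suc p)) (s≤s (s≤s p<n)) = alt-changes-everywhere j p p<n

antiRegStr-alternating : ∀ m → Alternating (antiRegStr m)
antiRegStr-alternating m with even-or-odd m
... | j , inj₁ refl = subst Alternating (sym (antiRegStr-even j))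
                        (λ p _ → alt-changes-everywhere j p)
... | j , inj₂ refl = subst Alternating (sym (antiRegStr-odd j))
                        (λ { (suc p) _ (s≤s p<n) → alt-changes-everywhere j p p<n })

antiRegular-bound : ∀ m a l → A m ≲ind G (a ∷ l) → m ≤ 2 + totalChanges l
antiRegular-bound m a l e = subst (_≤ 2 + totalChanges l) (length-antiRegStr m)
  (alternating-bound (antiRegStr m) a l (antiRegStr-alternating m) e)

replicate-⊆ : ∀ {A : Set} (x : A) {m n} → m ≤ n → replicate m x ⊆ replicate n x
replicate-⊆ x {zero}  _         = minimum _
replicate-⊆ x {suc m} (s≤s m≤n) = refl ∷ replicate-⊆ x m≤n

-- One bit from each block spells (01)^k; the leading block may keep more
-- zeros.
alt-⊆-blocks : ∀ bs → AllPos bs → alt (length bs) ⊆ blockStr bs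

leading-⊆ : ∀ {s s₁ t₁ bs} → s ≤ s₁ → AllPos ((s₁ , t₁) ∷ bs) →
            replicate s false ++ true ∷ alt (length bs) ⊆ blockStr ((s₁ , t₁) ∷ bs)
leading-⊆ s≤s₁ (_∷_ _ 1≤t pos) =
  ++⁺ (replicate-⊆ false s≤s₁) (++⁺ (replicate-⊆ true 1≤t) (alt-⊆-blocks _ pos))

alt-⊆-blocks []      []                = []
alt-⊆-blocks (_ ∷ _) pos@(_∷_ 1≤s _ _) = leading-⊆ 1≤s pos

totalChanges-replicate : ∀ n x r → totalChanges (replicate (suc n) x ++ r) ≡ totalChanges (x ∷ r)
totalChanges-replicate zero    x r = refl
totalChanges-replicate (suc n) x r =
  trans (cong (_+ totalChanges (x ∷ replicate n x ++ r)) (change-refl x))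
        (totalChanges-replicate n x r)

-- Each block boundary is one change: after the leading zeros of the first
-- block, 2k - 1 changes remain, and after its leading ones, 2k - 2.
changes-after-ones : ∀ {t bs} → 1 ≤ t → AllPos bs →
                     totalChanges (replicate t true ++ blockStr bs) ≡ 2 * length bs

changes-after-zeros : ∀ {s t bs} → 1 ≤ s → 1 ≤ t → AllPos bs →
                      totalChanges (replicate s false ++ replicate t true ++ blockStr bs) ≡ 2 * length bs + 1
changes-after-zeros {suc s} {t} {bs} (s≤s z≤n) 1≤t pos = begin
  totalChanges (replicate (suc s) false ++ replicate t true ++ blockStr bs)
    ≡⟨ totalChanges-replicate s false (replicate t true ++ blockStr bs) ⟩
  totalChanges (false ∷ replicate t true ++ blockStr bs)
    ≡⟨ ones-follow 1≤t ⟩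
  suc (totalChanges (replicate t true ++ blockStr bs))
    ≡⟨ cong suc (changes-after-ones 1≤t pos) ⟩
  suc (2 * length bs)
    ≡⟨ +-comm 1 (2 * length bs) ⟩
  2 * length bs + 1 ∎
  where
  ones-follow : ∀ {t} → 1 ≤ t → totalChanges (false ∷ replicate t true ++ blockStr bs) ≡
                                suc (totalChanges (replicate t true ++ blockStr bs))
  ones-follow (s≤s z≤n) = refl

changes-after-ones {suc t} {[]} (s≤s z≤n) [] = totalChanges-replicate t true []
changes-after-ones {suc t} {(suc s , t′) ∷ bs} (s≤s z≤n) pos@(_∷_ _ 1≤t′ pos′) = begin
  totalChanges (replicate (suc t) true ++ blockStr ((suc s , t′) ∷ bs))
    ≡⟨ totalChanges-replicate t true (blockStr ((suc s , t′) ∷ bs)) ⟩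
  suc (totalChanges (replicate (suc s) false ++ replicate t′ true ++ blockStr bs))
    ≡⟨ cong suc (changes-after-zeros {suc s} (s≤s z≤n) 1≤t′ pos′) ⟩
  suc (2 * length bs + 1)
    ≡⟨ cong suc (+-comm (2 * length bs) 1) ⟩
  2 + 2 * length bs
    ≡⟨ sym (*-suc 2 (length bs)) ⟩
  2 * suc (length bs) ∎

IsLargestAntiRegular : ℕ → Graph → Set
IsLargestAntiRegular m H = (A m ≲ind H) × (∀ m′ → 2 ≤ m′ → A m′ ≲ind H → m′ ≤ m)

-- s₁ = 1: (01)^k is a subsequence of b, and the tail of b has 2k - 2 changes.
one-leading-zero : ∀ s₁ t₁ bs → AllPos ((s₁ , t₁) ∷ bs) → s₁ ≡ 1 →
  IsLargestAntiRegular (2 * length ((s₁ , t₁) ∷ bs)) (G (blockStr ((s₁ , t₁) ∷ bs)))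
one-leading-zero .1 t₁ bs pos@(_∷_ _ 1≤t pos′) refl = embedded , bounded
  where
  k = length ((1 , t₁) ∷ bs)
  embedded : A (2 * k) ≲ind G (blockStr ((1 , t₁) ∷ bs))
  embedded = subst (λ c → G c ≲ind G (blockStr ((1 , t₁) ∷ bs))) (sym (antiRegStr-even k))
                   (sublist⇒induced (leading-⊆ ≤-refl pos))
  bounded : ∀ m′ → 2 ≤ m′ → A m′ ≲ind G (blockStr ((1 , t₁) ∷ bs)) → m′ ≤ 2 * k
  bounded m′ _ e = subst (m′ ≤_)
    (trans (cong (2 +_) (changes-after-ones 1≤t pos′)) (sym (*-suc 2 (length bs))))
    (antiRegular-bound m′ false _ e)

-- s₁ ≥ 2: 0(01)^k is a subsequence of b, and the tail of b has 2k - 1 changes.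
many-leading-zeros : ∀ s₁ t₁ bs → AllPos ((s₁ , t₁) ∷ bs) → 2 ≤ s₁ →
  IsLargestAntiRegular (2 * length ((s₁ , t₁) ∷ bs) + 1) (G (blockStr ((s₁ , t₁) ∷ bs)))
many-leading-zeros (suc (suc s)) t₁ bs pos@(_∷_ _ 1≤t pos′) (s≤s (s≤s z≤n)) = embedded , bounded
  where
  k = length ((suc (suc s) , t₁) ∷ bs)
  embedded : A (2 * k + 1) ≲ind G (blockStr ((suc (suc s) , t₁) ∷ bs))
  embedded = subst (λ c → G c ≲ind G (blockStr ((suc (suc s) , t₁) ∷ bs))) (sym (antiRegStr-odd k))
                   (sublist⇒induced (leading-⊆ (s≤s (s≤s z≤n)) pos))
  bounded : ∀ m′ → 2 ≤ m′ → A m′ ≲ind G (blockStr ((suc (suc s) , t₁) ∷ bs)) → m′ ≤ 2 * k + 1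
  bounded m′ _ e = subst (m′ ≤_)
    (trans (cong (2 +_) (changes-after-zeros {suc s} (s≤s z≤n) 1≤t pos′))
           (cong (_+ 1) (sym (*-suc 2 (length bs)))))
    (antiRegular-bound m′ false _ e)

theorem3p2 : (s₁ t₁ : ℕ) (bs : List (ℕ × ℕ)) → AllPos ((s₁ , t₁) ∷ bs) →
    let k = length ((s₁ , t₁) ∷ bs)
        Gb = G (blockStr ((s₁ , t₁) ∷ bs))
    in (s₁ ≡ 1 → (A (2 * k) ≲ind Gb) × (∀ m′ → 2 ≤ m′ → A m′ ≲ind Gb → m′ ≤ 2 * k))
     × (2 ≤ s₁ → (A (2 * k + 1) ≲ind Gb) × (∀ m′ → 2 ≤ m′ → A m′ ≲ind Gb → m′ ≤ 2 * k + 1))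
theorem3p2 s₁ t₁ bs pos = one-leading-zero s₁ t₁ bs pos , many-leading-zeros s₁ t₁ bs pos
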